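{- For all integers $r\ge1$ and $m\ge0$ with $r>m$, one has $f_{m+r+1,r}=0$.
   Context: A Ferrers diagram (FD) in $\mathbb{Z}_{\ge0}^{r}$ is a finite set $\lambda\subset\mathbb{Z}_{\ge0}^r$ (elements called nodes) such that if $\mathbf a\in\lambda$ and $0\le \mathbf x\le\mathbf a$ componentwise then $\mathbf x\in\lambda$. Let $\mu_r=\{0,e_1,\dots,e_r\}$ with $e_i$ the standard unit vectors. The support of a node is the set of indices of its nonzero coordinates; a node of type 1 is one of the form $e_i+e_j$ with $i\ne j$. For $r\ge1$, $m\ge0$, $f_{m+r+1,r}$ is the number of FDs $\lambda\subset\mathbb{Z}_{\ge0}^r$ with $\mu_r\subseteq\lambda$ and $|\lambda\setminus\mu_r|=m$ such that $\sigma=\lambda\setminus\mu_r$ has no reducible component in $\mathcal D$, meaning: there is no nonempty set $S\subseteq\{1,\dots,r\}$ such that every node of $\sigma$ has support contained in $S$ or in its complement, and every node of $\sigma$ with support contained in $S$ is of type 1. (In particular such $\sigma$ uses all $r$ coordinates, and $\lambda$ is not just $\mu_r$ together with type-1 nodes.) These numbers are the entries of the triangle $F=(f_{n,r})$, which together with binomial coefficients determine the numbers of partitions in every dimension. -}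

module Defs where

open import Data.Nat using (ℕ; zero; suc; _+_)
open import Data.Fin using (Fin; _≟_)
open import Data.Fin.Subset using (Subset; _∈_; _∉_; ∁; Nonempty)
open import Data.Vec using (Vec; tabulate; lookup; zipWith; replicate)
open import Data.Vec.Relation.Binary.Pointwise.Inductive using (Pointwise)
import Data.Vec.Properties as VecP
open import Data.Nat.Properties using () renaming (_≟_ to _≟ℕ_)
open import Data.List using (List; []; _∷_; filter; length)
open import Data.List.Membership.Propositional as LM using ()
open import Data.List.Membership.DecPropositional using ()
import Data.List.Membership.DecPropositional as DecMem
open import Data.List.Relation.Unary.Unique.Propositional using (Unique)
open import Data.Product using (Σ; ∃; ∃-syntax; _×_; _,_)
open import Data.Sum using (_⊎_)
open import Relation.Nullary using (¬_; Dec; yes; no; ¬?)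
open import Relation.Binary.PropositionalEquality using (_≡_; _≢_)

Node : ℕ → Set
Node r = Vec ℕ r

_≤ᵥ_ : ∀ {r} → Node r → Node r → Set
_≤ᵥ_ = Pointwise Data.Nat._≤_

𝟎 : ∀ {r} → Node r
𝟎 = replicate _ 0

e : ∀ {r} → Fin r → Node r
e i = tabulate λ k → δ k
  where
  δ : Fin _ → ℕ
  δ k with k ≟ i
  ... | yes _ = 1
  ... | no  _ = 0

_+ᵥ_ : ∀ {r} → Node r → Node r → Node r
_+ᵥ_ = zipWith _+_

μ : (r : ℕ) → List (Node r)
μ r = 𝟎 ∷ Data.List.map e (Data.List.allFin r)

_∈ₗ_ : ∀ {r} → Node r → List (Node r) → Set
x ∈ₗ xs = x LM.∈ xs

_∈ₗ?_ : ∀ {r} (x : Node r) (xs : List (Node r)) → Dec (x ∈ₗ xs)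
_∈ₗ?_ {r} x xs = DecMem._∈?_ (VecP.≡-dec _≟ℕ_) x xs

-- Ferrers diagram: finite (duplicate-free list) and downward closed
IsFD : ∀ {r} → List (Node r) → Set
IsFD lam = Unique lam × (∀ a → a ∈ₗ lam → ∀ x → x ≤ᵥ a → x ∈ₗ lam)

ContainsMu : ∀ {r} → List (Node r) → Set
ContainsMu {r} lam = ∀ x → x ∈ₗ μ r → x ∈ₗ lam

sigma : ∀ {r} → List (Node r) → List (Node r)
sigma {r} lam = filter (λ x → ¬? (x ∈ₗ? μ r)) lam

SuppIn : ∀ {r} → Node r → Subset r → Set
SuppIn x S = ∀ i → lookup x i ≢ 0 → i ∈ S

Type1 : ∀ {r} → Node r → Set
Type1 x = ∃[ i ] ∃[ j ] (i ≢ j × x ≡ e i +ᵥ e j)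

HasReducibleComponent : ∀ {r} → List (Node r) → Set
HasReducibleComponent {r} σ =
  Σ (Subset r) λ S → Nonempty S ×
    (∀ x → x ∈ₗ σ → (SuppIn x S ⊎ SuppIn x (∁ S)) × (SuppIn x S → Type1 x))

-- The FDs counted by f_{m+r+1,r}
Counted : (r m : ℕ) → List (Node r) → Set
Counted r m lam =
  IsFD lam × ContainsMu lam × length (sigma lam) ≡ m × ¬ HasReducibleComponent (sigma lam)

-- Build a graph on the coordinates 1..r plus an extra vertex ⋆: a type-1 node e_i + e_j of σ
-- joins i and j, and any other node joins ⋆ to some coordinate of its support. With m < r
-- edges on r + 1 vertices the graph is disconnected, so it has a 2-colouring constant along
-- edges that puts some coordinate on the other side from ⋆; let S be that side. Downward
-- closure of λ is what makes S work: a node of σ whose support met both S and its complement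
-- would lie above a type-1 node e_i + e_j of σ joining the two sides, and a node of σ that is
-- not of type 1 has a coordinate joined to ⋆, hence outside S.
module Submission where

open import Defs
open import Data.Nat using (ℕ; _≤_; _<_)
open import Data.List using (List)
open import Data.Product using (∃)
open import Relation.Nullary using (¬_)

open import Data.Bool using (Bool; true; false; _xor_)
open import Data.Bool.Properties using (xor-same) renaming (_≟_ to _≟ᵇ_)
open import Data.Empty using (⊥-elim)
open import Function using (_∋_)
open import Data.Fin using (Fin; zero; suc; _≟_)
open import Data.Fin.Properties using (any?)
open import Data.Fin.Subset using (_∈_; ∁; Nonempty)
open import Data.Fin.Subset.Properties using (x∉p⇒x∈∁p)
open import Data.List using (length; map)
open import Data.List.Properties using (length-map; length-removeAt′)
open import Data.List.Membership.Propositional.Properties using (∈-filter⁺; ∈-filter⁻; ∈-map⁻)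
open import Data.List.Relation.Unary.All as All using (All; all?)
open import Data.List.Relation.Unary.All.Properties using (¬All⇒Any¬; ─⁻; map⁻)
open import Data.List.Relation.Unary.Any as Any using (Any; here; there; _─_)
open import Data.List.Relation.Unary.Any.Properties using (lookup-result)
open import Data.Nat using (zero; suc; _+_; z≤n; s≤s⁻¹)
open import Data.Nat.Properties using (n≢0⇒n>0) renaming (_≟_ to _≟ℕ_)
open import Data.Product using (_×_; _,_; proj₁; proj₂; ∃-syntax)
open import Data.Sum using (_⊎_; inj₁; inj₂)
open import Data.Vec using ([]; _∷_; lookup; tabulate)
import Data.Vec.Properties as Vec
open import Data.Vec.Relation.Binary.Pointwise.Extensional using (ext; extensional⇒inductive)
open import Relation.Nullary using (Dec; yes; no; ¬?)
open import Relation.Nullary.Decidable using (_×-dec_)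
open import Relation.Unary using (Decidable)
open import Relation.Binary.PropositionalEquality
  using (_≡_; _≢_; refl; sym; trans; cong; cong₂; subst; ≢-sym)

Edge : ℕ → Set
Edge n = Fin n × Fin n

Respects : ∀ {n} → (Fin n → Bool) → Edge n → Set
Respects c (a , b) = c a ≡ c b

respects? : ∀ {n} (c : Fin n → Bool) → Decidable (Respects c)
respects? c (a , b) = c a ≟ᵇ c b

isZero : ∀ {n} → Fin (suc n) → Bool
isZero zero    = true
isZero (suc _) = false

merge0 : ∀ {n} → Fin n → Fin (suc n) → Fin n
merge0 w zero    = w
merge0 w (suc k) = k

contract : ∀ {n} → Fin n → List (Edge (suc n)) → List (Edge n)
contract w = map λ (a , b) → merge0 w a , merge0 w b

merge0-crossing : ∀ {n} {a b : Fin (suc n)} → isZero a ≢ isZero b → ∃[ w ] merge0 w a ≡ merge0 w b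
merge0-crossing {a = zero}  {zero}  ne = ⊥-elim (ne refl)
merge0-crossing {a = zero}  {suc w} _  = w , refl
merge0-crossing {a = suc w} {zero}  _  = w , refl
merge0-crossing {a = suc _} {suc _} ne = ⊥-elim (ne refl)

length-contract-─ : ∀ {n p} {P : Edge (suc n) → Set p}
                    (w : Fin n) (g : List (Edge (suc n))) (e∈g : Any P g) →
                    suc (length (contract w (g ─ e∈g))) ≡ length g
length-contract-─ w g e∈g =
  trans (cong suc (length-map _ (g ─ e∈g))) (sym (length-removeAt′ g (Any.index e∈g)))

-- Either isZero is one, or some edge joins
-- zero to a vertex w, and contracting it loses one vertex and at least one edge.
sparse-graph-disconnected : ∀ n (g : List (Edge (suc n))) → length g < n →
                            ∃[ c ] All (Respects c) g × ∃[ i ] ∃[ j ] c i ≢ c j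
sparse-graph-disconnected zero    g ()
sparse-graph-disconnected (suc n) g |g|<1+n with all? (respects? isZero) g
... | yes isZero-respects = isZero , isZero-respects , zero , suc zero , λ ()
... | no ¬isZero-respects
  with crossing ← ¬All⇒Any¬ (respects? isZero) g ¬isZero-respects
  with w , merged ← merge0-crossing (lookup-result crossing)
  with c , respects , i , j , ci≢cj ← sparse-graph-disconnected n (contract w (g ─ crossing))
                                 (subst (_≤ n) (sym (length-contract-─ w g crossing)) (s≤s⁻¹ |g|<1+n))
  = (λ v → c (merge0 w v)) , ─⁻ crossing (cong c merged) (map⁻ respects) , suc i , suc j , ci≢cj

distinct-from-zero : ∀ {n} (c : Fin (suc n) → Bool) {i j} → c i ≢ c j → ∃[ k ] c (suc k) ≢ c zero
distinct-from-zero c {zero}  {zero}  ne = ⊥-elim (ne refl)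
distinct-from-zero c {zero}  {suc l} ne = l , λ eq → ne (sym eq)
distinct-from-zero c {suc k} {zero}  ne = k , ne
distinct-from-zero c {suc k} {suc l} ne with c (suc k) ≟ᵇ c zero
... | no  ck≢c0 = k , ck≢c0
... | yes ck≡c0 = l , λ cl≡c0 → ne (trans ck≡c0 (sym cl≡c0))

-- The ∋ annotations fix the tabulated function, so that `with` can abstract the
-- comparison k ≟ i occurring in its value.
lookup-e-≡ : ∀ {r} (i : Fin r) → lookup (e i) i ≡ 1
lookup-e-≡ i with i ≟ i | lookup (e i) i ≡ _ ∋ Vec.lookup∘tabulate _ i
... | yes _   | eq = eq
... | no  i≢i | _  = ⊥-elim (i≢i refl)

lookup-e-≢ : ∀ {r} {i k : Fin r} → k ≢ i → lookup (e i) k ≡ 0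
lookup-e-≢ {i = i} {k} k≢i with k ≟ i | lookup (e i) k ≡ _ ∋ Vec.lookup∘tabulate _ k
... | yes k≡i | _  = ⊥-elim (k≢i k≡i)
... | no  _   | eq = eq

e-support : ∀ {r} {i k : Fin r} → lookup (e i) k ≢ 0 → k ≡ i
e-support {i = i} {k} nonzero with k ≟ i
... | yes k≡i = k≡i
... | no  k≢i = ⊥-elim (nonzero (lookup-e-≢ k≢i))

lookup-+ᵥ : ∀ {r} (x y : Node r) k → lookup (x +ᵥ y) k ≡ lookup x k + lookup y k
lookup-+ᵥ x y k = Vec.lookup-zipWith _+_ k x y

lookup-e+eˡ : ∀ {r} {i j : Fin r} → i ≢ j → lookup (e i +ᵥ e j) i ≡ 1
lookup-e+eˡ {i = i} {j} i≢j =
  trans (lookup-+ᵥ (e i) (e j) i) (cong₂ _+_ (lookup-e-≡ i) (lookup-e-≢ i≢j))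

lookup-e+eʳ : ∀ {r} {i j : Fin r} → i ≢ j → lookup (e i +ᵥ e j) j ≡ 1
lookup-e+eʳ {i = i} {j} i≢j =
  trans (lookup-+ᵥ (e i) (e j) j) (cong₂ _+_ (lookup-e-≢ (≢-sym i≢j)) (lookup-e-≡ j))

lookup-e+e-outside : ∀ {r} {i j k : Fin r} → k ≢ i → k ≢ j → lookup (e i +ᵥ e j) k ≡ 0
lookup-e+e-outside {i = i} {j} {k} k≢i k≢j =
  trans (lookup-+ᵥ (e i) (e j) k) (cong₂ _+_ (lookup-e-≢ k≢i) (lookup-e-≢ k≢j))

e+e-support : ∀ {r} {i j k : Fin r} → lookup (e i +ᵥ e j) k ≢ 0 → k ≡ i ⊎ k ≡ j
e+e-support {i = i} {j} {k} nonzero with k ≟ i | k ≟ j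
... | yes k≡i | _       = inj₁ k≡i
... | no  _   | yes k≡j = inj₂ k≡j
... | no  k≢i | no  k≢j = ⊥-elim (nonzero (lookup-e+e-outside k≢i k≢j))

one≢0 : ∀ {n} → n ≡ 1 → n ≢ 0
one≢0 refl ()

-- e i +ᵥ e j determines the pair {i, j}.
e+e-colour : ∀ {r} (T : Fin r → Bool) {i j i′ j′ : Fin r} → i ≢ j → e i +ᵥ e j ≡ e i′ +ᵥ e j′ →
             T i′ ≡ T j′ → T i ≡ T j
e+e-colour T {i} {j} {i′} {j′} i≢j eq Ti′≡Tj′ =
  trans (colour (lookup-e+eˡ i≢j)) (sym (colour (lookup-e+eʳ i≢j)))
  where
  colour : ∀ {k} → lookup (e i +ᵥ e j) k ≡ 1 → T k ≡ T i′
  colour {k} one with e+e-support {i = i′} {j′} (subst (λ v → lookup v k ≢ 0) eq (one≢0 one))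
  ... | inj₁ refl = refl
  ... | inj₂ refl = sym Ti′≡Tj′

e+e≤ᵥ : ∀ {r} {i j : Fin r} {x : Node r} → i ≢ j → lookup x i ≢ 0 → lookup x j ≢ 0 →
        (e i +ᵥ e j) ≤ᵥ x
e+e≤ᵥ {i = i} {j} {x} i≢j xi≢0 xj≢0 = extensional⇒inductive (ext bound)
  where
  bound : ∀ k → lookup (e i +ᵥ e j) k ≤ lookup x k
  bound k with k ≟ i | k ≟ j
  ... | yes refl | _        = subst (_≤ lookup x i) (sym (lookup-e+eˡ i≢j)) (n≢0⇒n>0 xi≢0)
  ... | no  _    | yes refl = subst (_≤ lookup x j) (sym (lookup-e+eʳ i≢j)) (n≢0⇒n>0 xj≢0)
  ... | no  k≢i  | no  k≢j  = subst (_≤ lookup x k) (sym (lookup-e+e-outside k≢i k≢j)) z≤n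

e+e∉μ : ∀ {r} {i j : Fin r} → i ≢ j → ¬ (e i +ᵥ e j) ∈ₗ μ r
e+e∉μ {i = i} i≢j (here eq) =
  one≢0 (lookup-e+eˡ i≢j) (trans (cong (λ v → lookup v i) eq) (Vec.lookup-replicate i 0))
e+e∉μ {i = i} {j} i≢j (there mem) with ∈-map⁻ e mem
... | k , _ , eq = i≢j (trans (at-k (lookup-e+eˡ i≢j)) (sym (at-k (lookup-e+eʳ i≢j))))
  where
  at-k : ∀ {l} → lookup (e i +ᵥ e j) l ≡ 1 → l ≡ k
  at-k {l} one = e-support (subst (λ v → lookup v l ≢ 0) eq (one≢0 one))

nonzero-coordinate : ∀ {r} {x : Node r} → x ≢ 𝟎 → ∃[ i ] lookup x i ≢ 0
nonzero-coordinate {x = []}    x≢𝟎 = ⊥-elim (x≢𝟎 refl)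
nonzero-coordinate {x = a ∷ x} a∷x≢𝟎 with a ≟ℕ 0
... | no  a≢0 = zero , a≢0
... | yes refl with nonzero-coordinate {x = x} (λ x≡𝟎 → a∷x≢𝟎 (cong (0 ∷_) x≡𝟎))
...   | i , xi≢0 = suc i , xi≢0

type1? : ∀ {r} (x : Node r) → Dec (Type1 x)
type1? x = any? λ i → any? λ j → ¬? (i ≟ j) ×-dec Vec.≡-dec _≟ℕ_ x (e i +ᵥ e j)

-- The vertex zero of Fin (suc r) plays ⋆ and suc i plays the coordinate i.
nodeEdge : ∀ {r} → Node r → Edge (suc r)
nodeEdge x with type1? x | any? (λ i → ¬? (lookup x i ≟ℕ 0))
... | yes (i , j , _) | _           = suc i , suc j
... | no  _           | yes (i , _) = suc i , zero
... | no  _           | no  _       = zero , zero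

farFromZero : ∀ {n} → (Fin (suc n) → Bool) → Fin n → Bool
farFromZero c k = c (suc k) xor c zero

xor-≢ : ∀ {x y} → x ≢ y → x xor y ≡ true
xor-≢ {true}  {true}  ne = ⊥-elim (ne refl)
xor-≢ {true}  {false} _  = refl
xor-≢ {false} {true}  _  = refl
xor-≢ {false} {false} ne = ⊥-elim (ne refl)

Compatible : ∀ {r} → (Fin r → Bool) → Node r → Set
Compatible T x = (∀ {i j} → i ≢ j → x ≡ e i +ᵥ e j → T i ≡ T j)
               × (¬ Type1 x → ∃[ i ] lookup x i ≢ 0 × T i ≡ false)

nodeEdge-compatible : ∀ {r} (c : Fin (suc r) → Bool) (x : Node r) → x ≢ 𝟎 →
                      Respects c (nodeEdge x) → Compatible (farFromZero c) x
nodeEdge-compatible c x x≢𝟎 respects with type1? x | any? (λ i → ¬? (lookup x i ≟ℕ 0))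
... | yes type1@(_ , _ , _ , x≡e′) | _ =
  (λ i≢j x≡e → e+e-colour (farFromZero c) i≢j (trans (sym x≡e) x≡e′) (cong (_xor c zero) respects))
  , λ ¬type1 → ⊥-elim (¬type1 type1)
... | no ¬type1 | yes (i , xi≢0) =
  (λ i≢j x≡e → ⊥-elim (¬type1 (_ , _ , i≢j , x≡e)))
  , λ _ → i , xi≢0 , trans (cong (_xor c zero) respects) (xor-same (c zero))
... | no _      | no ¬nonzero = ⊥-elim (¬nonzero (nonzero-coordinate x≢𝟎))

∈-tabulate⁺ : ∀ {n} {T : Fin n → Bool} {i} → T i ≡ true → i ∈ tabulate T
∈-tabulate⁺ {T = T} {i} Ti = Vec.lookup⇒[]= i (tabulate T) (trans (Vec.lookup∘tabulate T i) Ti)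

∈-tabulate⁻ : ∀ {n} {T : Fin n → Bool} {i} → i ∈ tabulate T → T i ≡ true
∈-tabulate⁻ {T = T} {i} i∈ = trans (sym (Vec.lookup∘tabulate T i)) (Vec.[]=⇒lookup i∈)

∈∁-tabulate⁺ : ∀ {n} {T : Fin n → Bool} {i} → T i ≡ false → i ∈ ∁ (tabulate T)
∈∁-tabulate⁺ Ti = x∉p⇒x∈∁p λ i∈ → true≢false (trans (sym (∈-tabulate⁻ i∈)) Ti)
  where
  true≢false : true ≢ false
  true≢false ()

module _ {r} {lam : List (Node r)} where

  ∈σ⁻ : ∀ {x} → x ∈ₗ sigma lam → x ∈ₗ lam × ¬ x ∈ₗ μ r
  ∈σ⁻ = ∈-filter⁻ (λ y → ¬? (y ∈ₗ? μ r))

  ∈σ-nonzero : ∀ {x} → x ∈ₗ sigma lam → x ≢ 𝟎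
  ∈σ-nonzero x∈σ refl = proj₂ (∈σ⁻ x∈σ) (here refl)

  module _ (closed : ∀ a → a ∈ₗ lam → ∀ x → x ≤ᵥ a → x ∈ₗ lam)
           (T : Fin r → Bool) (compatible : ∀ {x} → x ∈ₗ sigma lam → Compatible T x) where

    support-monochromatic : ∀ {x i j} → x ∈ₗ sigma lam → lookup x i ≢ 0 → lookup x j ≢ 0 → T i ≡ T j
    support-monochromatic {x} {i} {j} x∈σ xi≢0 xj≢0 with i ≟ j
    ... | yes refl = refl
    ... | no  i≢j  = proj₁ (compatible e+e∈σ) i≢j refl
      where
      e+e∈σ : (e i +ᵥ e j) ∈ₗ sigma lam
      e+e∈σ = ∈-filter⁺ (λ y → ¬? (y ∈ₗ? μ r))
                (closed x (proj₁ (∈σ⁻ x∈σ)) _ (e+e≤ᵥ i≢j xi≢0 xj≢0)) (e+e∉μ i≢j)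

    support-one-side : ∀ {x} → x ∈ₗ sigma lam → SuppIn x (tabulate T) ⊎ SuppIn x (∁ (tabulate T))
    support-one-side x∈σ with nonzero-coordinate (∈σ-nonzero x∈σ)
    ... | i , xi≢0 with T i in Ti
    ...   | true  = inj₁ λ j xj≢0 → ∈-tabulate⁺ (trans (sym (support-monochromatic x∈σ xi≢0 xj≢0)) Ti)
    ...   | false = inj₂ λ j xj≢0 → ∈∁-tabulate⁺ (trans (sym (support-monochromatic x∈σ xi≢0 xj≢0)) Ti)

    inside⇒type1 : ∀ {x} → x ∈ₗ sigma lam → SuppIn x (tabulate T) → Type1 x
    inside⇒type1 {x} x∈σ inside with type1? x
    ... | yes type1 = type1
    ... | no ¬type1 with proj₂ (compatible x∈σ) ¬type1
    ...   | i , xi≢0 , Ti≡false with () ← trans (sym (∈-tabulate⁻ (inside i xi≢0))) Ti≡false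

    reducible : Nonempty (tabulate T) → HasReducibleComponent (sigma lam)
    reducible nonempty = tabulate T , nonempty , λ _ x∈σ → support-one-side x∈σ , inside⇒type1 x∈σ

-- The hypothesis 1 ≤ r is implied by m < r.
proposition3 : (r m : ℕ) → 1 ≤ r → m < r → ¬ (∃ λ (lam : List (Node r)) → Counted r m lam)
proposition3 r m _ m<r (lam , (_ , closed) , _ , |σ|≡m , irreducible)
  with c , respects , _ , _ , c-nonconstant
         ← sparse-graph-disconnected r (map nodeEdge (sigma lam))
             (subst (_< r) (sym (trans (length-map nodeEdge (sigma lam)) |σ|≡m)) m<r)
  with k , ck≢c0 ← distinct-from-zero c c-nonconstant
  = irreducible (reducible closed (farFromZero c) compatible (k , ∈-tabulate⁺ (xor-≢ ck≢c0)))
  where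
  compatible : ∀ {x} → x ∈ₗ sigma lam → Compatible (farFromZero c) x
  compatible x∈σ =
    nodeEdge-compatible c _ (∈σ-nonzero {lam = lam} x∈σ) (All.lookup (map⁻ respects) x∈σ)
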